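{- There exists a symmetric chain decomposition of the $6$-dimensional hypercube $Q_6$ that cannot be extended to a Hamilton cycle of $Q_6$; that is, there is a partition of the vertex set of $Q_6$ into symmetric chains such that no Hamilton cycle of $Q_6$ contains every chain of the partition as a subpath.
   Context: The $n$-dimensional hypercube $Q_n$ is the graph whose vertices are all bitstrings of length $n$, two bitstrings being adjacent if they differ in exactly one bit. The weight of a bitstring is its number of 1s. A symmetric chain in $Q_n$ is a path $x_k,x_{k+1},\ldots,x_{n-k}$ in $Q_n$ (for some $0\le k\le n/2$) such that $x_i$ has weight $i$ for all $i=k,\ldots,n-k$ (a single vertex of weight $n/2$ counts as a symmetric chain when $n$ is even). A symmetric chain decomposition of $Q_n$ is a partition of the vertex set of $Q_n$ into symmetric chains. A symmetric chain decomposition is said to extend to a Hamilton cycle if there is a Hamilton cycle of $Q_n$ containing all edges of all chains of the decomposition, i.e., each chain appears as a contiguous subpath of the cycle. -}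

module Defs where

open import Data.Nat using (ℕ; zero; suc; _+_; _*_; _∸_; _≤_)
open import Data.Bool using (Bool; true; false)
open import Data.Vec using (Vec; []; _∷_)
open import Data.List using (List; []; _∷_; _++_; length; concat; take)
open import Data.List.Membership.Propositional using (_∈_)
open import Data.List.Relation.Unary.Unique.Propositional using (Unique)
open import Data.List.Relation.Unary.All using (All)
open import Data.List.Relation.Unary.Linked using (Linked)
open import Data.Product using (Σ; ∃; ∃-syntax; _×_)
open import Data.Sum using (_⊎_)
open import Data.Unit using (⊤)
open import Relation.Binary.PropositionalEquality using (_≡_)

Vertex : ℕ → Set
Vertex n = Vec Bool n

weight : ∀ {n} → Vertex n → ℕ
weight []          = 0
weight (true ∷ x)  = suc (weight x)
weight (false ∷ x) = weight x

hamming : ∀ {n} → Vertex n → Vertex n → ℕ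
hamming []      []      = 0
hamming (true  ∷ x) (true  ∷ y) = hamming x y
hamming (false ∷ x) (false ∷ y) = hamming x y
hamming (true  ∷ x) (false ∷ y) = suc (hamming x y)
hamming (false ∷ x) (true  ∷ y) = suc (hamming x y)

Adj : ∀ {n} → Vertex n → Vertex n → Set
Adj x y = hamming x y ≡ 1

WeightsFrom : ∀ {n} → ℕ → List (Vertex n) → Set
WeightsFrom w []       = ⊤
WeightsFrom w (x ∷ xs) = (weight x ≡ w) × WeightsFrom (suc w) xs

-- A symmetric chain x_k, x_{k+1}, ..., x_{n-k} (0 ≤ k ≤ n/2): a path in Q_n
-- whose i-th vertex has weight i.
SymmetricChain : (n : ℕ) → List (Vertex n) → Set
SymmetricChain n c =
  ∃[ k ] ((k + k ≤ n) × (length c ≡ suc (n ∸ (k + k))) × WeightsFrom k c × Linked Adj c)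

SCD : (n : ℕ) → List (List (Vertex n)) → Set
SCD n D = All (SymmetricChain n) D × Unique (concat D) × (∀ (v : Vertex n) → v ∈ concat D)

closeCycle : ∀ {A : Set} → List A → List A
closeCycle c = c ++ take 1 c

HamiltonCycle : (n : ℕ) → List (Vertex n) → Set
HamiltonCycle n c = Unique c × (∀ (v : Vertex n) → v ∈ c) × Linked Adj (closeCycle c)

CycleEdge : ∀ {n} → List (Vertex n) → Vertex n → Vertex n → Set
CycleEdge c u v =
  ∃[ xs ] ∃[ ys ] ((closeCycle c ≡ xs ++ (u ∷ v ∷ ys)) ⊎ (closeCycle c ≡ xs ++ (v ∷ u ∷ ys)))

EdgesIn : ∀ {n} → List (Vertex n) → List (Vertex n) → Set
EdgesIn c p = Linked (CycleEdge c) p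

ContainsChains : ∀ {n} → List (Vertex n) → List (List (Vertex n)) → Set
ContainsChains c D = All (EdgesIn c) D

ExtendsToHamiltonCycle : (n : ℕ) → List (List (Vertex n)) → Set
ExtendsToHamiltonCycle n D = ∃[ c ] (HamiltonCycle n c × ContainsChains c D)

-- In the decomposition D₆ below the vertex 111000 forms a chain on its own, while each of its
-- six neighbours in Q₆ lies strictly inside a longer chain, between two vertices other than
-- 111000. A Hamilton cycle containing all chains must use both chain edges at such an inner
-- vertex, yet it also has to leave 111000 through one of these neighbours; that neighbour
-- would then have three neighbours on the cycle.
module Submission where

open import Defs
open import Data.Bool using (true; false; not)
open import Data.Bool.Properties using () renaming (_≟_ to _≟ᵇ_)
open import Data.Empty using (⊥; ⊥-elim)
open import Data.Fin using (Fin; zero; suc)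
open import Data.List using (List; []; _∷_; _++_; [_]; length; map; concat; concatMap)
open import Data.List.Properties using (∷-injectiveˡ; ∷-injectiveʳ; ++-conicalʳ)
open import Data.List.Membership.Propositional using (_∈_)
open import Data.List.Membership.Propositional.Properties using (∈-++⁺ˡ; ∈-++⁺ʳ; ∈-map⁺)
open import Data.List.Relation.Unary.All as All using (All; []; _∷_)
open import Data.List.Relation.Unary.All.Properties using (concat⁺; map⁺)
open import Data.List.Relation.Unary.AllPairs using ([]; _∷_)
open import Data.List.Relation.Unary.Any using (here; there)
open import Data.List.Relation.Unary.Linked using (Linked; []; [-]; _∷_; linked?)
open import Data.List.Relation.Unary.Unique.Propositional using (Unique)
open import Data.List.Relation.Unary.Unique.Propositional.Properties
  using (Unique[x∷xs]⇒x∉xs) renaming (++⁺ to Unique-++⁺)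
open import Data.Nat using (ℕ; zero; suc; _+_; _∸_; _≡ᵇ_; _%_; _/_; _≤?_) renaming (_≟_ to _≟ℕ_)
open import Data.Nat.Properties using (suc-injective)
open import Data.Product using (∃-syntax; _×_; _,_; uncurry)
open import Data.Product.Properties using () renaming (≡-dec to ×-≡-dec)
open import Data.Sum using (inj₁; inj₂)
open import Data.Unit using (tt)
open import Data.Vec using ([]; _∷_; updateAt)
open import Data.Vec.Properties using () renaming (≡-dec to Vec-≡-dec)
open import Function using (case_of_)
open import Relation.Binary.Definitions using (DecidableEquality)
open import Relation.Binary.PropositionalEquality using (_≡_; _≢_; refl; sym; trans; cong; subst; ≢-sym)
open import Relation.Nullary using (¬_; Dec; yes; ¬?; _×-dec_)
open import Relation.Nullary.Decidable using (True; toWitness; from-yes)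

module _ {A : Set} where

  []≢++∷ : ∀ xs {y} {ys : List A} → [] ≢ xs ++ y ∷ ys
  []≢++∷ xs e = case ++-conicalʳ xs _ (sym e) of λ ()

  ∈-init : ∀ {P : List A} {z y b} xs {ys} → P ++ [ z ] ≡ xs ++ y ∷ b ∷ ys → y ∈ P
  ∈-init {[]}    []           ()
  ∈-init {[]}    (_ ∷ [])     ()
  ∈-init {[]}    (_ ∷ _ ∷ _)  ()
  ∈-init {_ ∷ _} []           e = here (sym (∷-injectiveˡ e))
  ∈-init {_ ∷ _} (_ ∷ xs)     e = there (∈-init xs (∷-injectiveʳ e))

  ∈-after : ∀ {y b} {ys zs : List A} xs → y ∷ ys ≡ xs ++ b ∷ y ∷ zs → y ∈ ys
  ∈-after []       e with refl ← ∷-injectiveʳ e = here refl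
  ∈-after (_ ∷ xs) e with refl ← ∷-injectiveʳ e = ∈-++⁺ʳ xs (there (here refl))

  successor-unique : ∀ {P : List A} {z y a b xs ys xs′ ys′} → Unique P →
                     P ++ [ z ] ≡ xs ++ y ∷ a ∷ ys → P ++ [ z ] ≡ xs′ ++ y ∷ b ∷ ys′ → a ≡ b
  successor-unique {[]} {xs = xs} _ e₁ _ = case ∈-init {P = []} xs e₁ of λ ()
  successor-unique {_ ∷ _} {xs = []} {xs′ = []} _ e₁ e₂ =
    ∷-injectiveˡ (trans (sym (∷-injectiveʳ e₁)) (∷-injectiveʳ e₂))
  successor-unique {_ ∷ _} {xs = []} {xs′ = _ ∷ xs′} u e₁ e₂ with refl ← ∷-injectiveˡ e₁ =
    ⊥-elim (Unique[x∷xs]⇒x∉xs u (∈-init xs′ (∷-injectiveʳ e₂)))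
  successor-unique {_ ∷ _} {xs = _ ∷ xs} {xs′ = []} u e₁ e₂ with refl ← ∷-injectiveˡ e₂ =
    ⊥-elim (Unique[x∷xs]⇒x∉xs u (∈-init xs (∷-injectiveʳ e₁)))
  successor-unique {_ ∷ _} {xs = _ ∷ _} {xs′ = _ ∷ _} (_ ∷ u) e₁ e₂ =
    successor-unique u (∷-injectiveʳ e₁) (∷-injectiveʳ e₂)

  predecessor-unique : ∀ {h} {Q : List A} {y a b xs ys xs′ ys′} → Unique Q →
                       h ∷ Q ≡ xs ++ a ∷ y ∷ ys → h ∷ Q ≡ xs′ ++ b ∷ y ∷ ys′ → a ≡ b
  predecessor-unique {xs = []} {xs′ = []} _ e₁ e₂ = trans (sym (∷-injectiveˡ e₁)) (∷-injectiveˡ e₂)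
  predecessor-unique {xs = []} {xs′ = _ ∷ xs′} u e₁ e₂ with refl ← ∷-injectiveʳ e₁ =
    ⊥-elim (Unique[x∷xs]⇒x∉xs u (∈-after xs′ (∷-injectiveʳ e₂)))
  predecessor-unique {xs = _ ∷ xs} {xs′ = []} u e₁ e₂ with refl ← ∷-injectiveʳ e₂ =
    ⊥-elim (Unique[x∷xs]⇒x∉xs u (∈-after xs (∷-injectiveʳ e₁)))
  predecessor-unique {Q = []} {xs = _ ∷ xs} {xs′ = _ ∷ _} _ e₁ _ = ⊥-elim ([]≢++∷ xs (∷-injectiveʳ e₁))
  predecessor-unique {Q = _ ∷ _} {xs = _ ∷ _} {xs′ = _ ∷ _} (_ ∷ u) e₁ e₂ =
    predecessor-unique u (∷-injectiveʳ e₁) (∷-injectiveʳ e₂)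

  Unique-rotate : ∀ {h} {Q : List A} → Unique (h ∷ Q) → Unique (Q ++ [ h ])
  Unique-rotate u@(_ ∷ uQ) = Unique-++⁺ uQ ([] ∷ []) λ where
    (h∈Q , here refl) → Unique[x∷xs]⇒x∉xs u h∈Q

  successor-exists : ∀ {P : List A} {x} z → x ∈ P → ∃[ xs ] ∃[ y ] ∃[ ys ] (P ++ [ z ] ≡ xs ++ x ∷ y ∷ ys)
  successor-exists {_ ∷ []}    z (here refl) = [] , z , [] , refl
  successor-exists {_ ∷ q ∷ P} z (here refl) = [] , q , P ++ [ z ] , refl
  successor-exists {p ∷ _}     z (there x∈P) =
    let xs , y , ys , e = successor-exists z x∈P in p ∷ xs , y , ys , cong (p ∷_) e

  Linked-consecutive : ∀ {R : A → A → Set} xs {x y ys} → Linked R (xs ++ x ∷ y ∷ ys) → R x y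
  Linked-consecutive []           (r ∷ _) = r
  Linked-consecutive (_ ∷ [])     (_ ∷ l) = Linked-consecutive [] l
  Linked-consecutive (_ ∷ w ∷ xs) (_ ∷ l) = Linked-consecutive (w ∷ xs) l

  consecutivePairs : List A → List (A × A)
  consecutivePairs (x ∷ y ∷ xs) = (x , y) ∷ consecutivePairs (y ∷ xs)
  consecutivePairs _            = []

  Linked⇒All-consecutivePairs : ∀ {R : A → A → Set} {xs} → Linked R xs → All (uncurry R) (consecutivePairs xs)
  Linked⇒All-consecutivePairs []      = []
  Linked⇒All-consecutivePairs [-]     = []
  Linked⇒All-consecutivePairs (r ∷ l) = r ∷ Linked⇒All-consecutivePairs l

flip : ∀ {n} → Fin n → Vertex n → Vertex n
flip i x = updateAt x i not

hamming≡0⇒≡ : ∀ {n} {x y : Vertex n} → hamming x y ≡ 0 → x ≡ y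
hamming≡0⇒≡ {x = []}        {[]}        _ = refl
hamming≡0⇒≡ {x = true ∷ _}  {true ∷ _}  h = cong (true ∷_) (hamming≡0⇒≡ h)
hamming≡0⇒≡ {x = false ∷ _} {false ∷ _} h = cong (false ∷_) (hamming≡0⇒≡ h)

adjacent⇒flip : ∀ {n} {x y : Vertex n} → Adj x y → ∃[ i ] (y ≡ flip i x)
adjacent⇒flip {x = []}       {[]}        ()
adjacent⇒flip {x = true ∷ _}  {true ∷ _}  h = let i , e = adjacent⇒flip h in suc i , cong (true ∷_) e
adjacent⇒flip {x = false ∷ _} {false ∷ _} h = let i , e = adjacent⇒flip h in suc i , cong (false ∷_) e
adjacent⇒flip {x = true ∷ _}  {false ∷ _} h = zero , cong (false ∷_) (sym (hamming≡0⇒≡ (suc-injective h)))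
adjacent⇒flip {x = false ∷ _} {true ∷ _}  h = zero , cong (true ∷_) (sym (hamming≡0⇒≡ (suc-injective h)))

CycleEdge-sym : ∀ {n} {c : List (Vertex n)} {u v} → CycleEdge c u v → CycleEdge c v u
CycleEdge-sym (xs , ys , inj₁ e) = xs , ys , inj₂ e
CycleEdge-sym (xs , ys , inj₂ e) = xs , ys , inj₁ e

-- Two neighbours on the same side of y coincide: successors are read off the duplicate-free
-- prefix h ∷ Q of closeCycle (h ∷ Q) = h ∷ Q ++ [ h ], predecessors off its suffix Q ++ [ h ].
¬threeCycleNeighbours : ∀ {n} {c : List (Vertex n)} {y a b d} → Unique c →
                        CycleEdge c y a → CycleEdge c y b → CycleEdge c y d → a ≢ b → a ≢ d → b ≢ d → ⊥
¬threeCycleNeighbours {c = []} _ (xs , _ , inj₁ e) _ _ _ _ _ = []≢++∷ xs e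
¬threeCycleNeighbours {c = []} _ (xs , _ , inj₂ e) _ _ _ _ _ = []≢++∷ xs e
¬threeCycleNeighbours {c = h ∷ Q} u (_ , _ , ea) (_ , _ , eb) (_ , _ , ed) a≢b a≢d b≢d with ea | eb | ed
... | inj₁ ea | inj₁ eb | _       = a≢b (successor-unique {P = h ∷ Q} u ea eb)
... | inj₂ ea | inj₂ eb | _       = a≢b (predecessor-unique (Unique-rotate u) ea eb)
... | inj₁ ea | inj₂ _  | inj₁ ed = a≢d (successor-unique {P = h ∷ Q} u ea ed)
... | inj₁ _  | inj₂ eb | inj₂ ed = b≢d (predecessor-unique (Unique-rotate u) eb ed)
... | inj₂ _  | inj₁ eb | inj₁ ed = b≢d (successor-unique {P = h ∷ Q} u eb ed)
... | inj₂ ea | inj₁ _  | inj₂ ed = a≢d (predecessor-unique (Unique-rotate u) ea ed)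

hamiltonCycle-adjacentNeighbour : ∀ {n c} → HamiltonCycle n c → (x : Vertex n) → ∃[ y ] (Adj x y × CycleEdge c x y)
hamiltonCycle-adjacentNeighbour {c = []} (_ , covers , _) x = case covers x of λ ()
hamiltonCycle-adjacentNeighbour {c = h ∷ Q} (_ , covers , linked) x
  with xs , y , ys , e ← successor-exists {P = h ∷ Q} h (covers x)
  = y , Linked-consecutive xs (subst (Linked Adj) e linked) , xs , ys , inj₁ e

chainEdges : ∀ {n} → List (List (Vertex n)) → List (Vertex n × Vertex n)
chainEdges = concatMap consecutivePairs

chainEdges⊆cycleEdges : ∀ {n} {c : List (Vertex n)} {D} → ContainsChains c D → All (uncurry (CycleEdge c)) (chainEdges D)
chainEdges⊆cycleEdges contains = concat⁺ (map⁺ (All.map Linked⇒All-consecutivePairs contains))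

Shielded : ∀ {n} → List (List (Vertex n)) → Vertex n → Vertex n → Set
Shielded D x y =
  ∃[ a ] ∃[ b ] ((a , y) ∈ chainEdges D × (y , b) ∈ chainEdges D × a ≢ b × x ≢ a × x ≢ b)

Shielded⇒¬CycleEdge : ∀ {n} {c : List (Vertex n)} {D x y} → Unique c → ContainsChains c D →
                      Shielded D x y → ¬ CycleEdge c y x
Shielded⇒¬CycleEdge {c = c} unique contains (_ , _ , ay , yb , a≢b , x≢a , x≢b) yx =
  ¬threeCycleNeighbours unique (CycleEdge-sym {c = c} (All.lookup edges ay)) (All.lookup edges yb) yx
                        a≢b (≢-sym x≢a) (≢-sym x≢b)
  where edges = chainEdges⊆cycleEdges {c = c} contains

weightsFrom? : ∀ {n} w (c : List (Vertex n)) → Dec (WeightsFrom w c)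
weightsFrom? w []      = yes tt
weightsFrom? w (x ∷ c) = weight x ≟ℕ w ×-dec weightsFrom? (suc w) c

adjacent? : ∀ {n} (x y : Vertex n) → Dec (Adj x y)
adjacent? x y = hamming x y ≟ℕ 1

bitstrings : ∀ n → List (Vertex n)
bitstrings zero    = [ [] ]
bitstrings (suc n) = map (false ∷_) (bitstrings n) ++ map (true ∷_) (bitstrings n)

∈-bitstrings : ∀ {n} (v : Vertex n) → v ∈ bitstrings n
∈-bitstrings []          = here refl
∈-bitstrings (false ∷ v) = ∈-++⁺ˡ (∈-map⁺ (false ∷_) (∈-bitstrings v))
∈-bitstrings (true ∷ v)  = ∈-++⁺ʳ _ (∈-map⁺ (true ∷_) (∈-bitstrings v))

_≟_ : ∀ {n} → DecidableEquality (Vertex n)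
_≟_ = Vec-≡-dec _≟ᵇ_

-- Bit j of vertex m is the binary digit of m of weight 2^j, so vertex 7 is 111000.
vertex : ℕ → Vertex 6
vertex = binary 6
  where
  binary : ∀ n → ℕ → Vertex n
  binary zero    _ = []
  binary (suc n) m = (m % 2 ≡ᵇ 1) ∷ binary n (m / 2)

D₆ : List (List (Vertex 6))
D₆ = map (map vertex)
  ( (0 ∷ 16 ∷ 20 ∷ 22 ∷ 23 ∷ 31 ∷ 63 ∷ [])
  ∷ (1 ∷ 5 ∷ 13 ∷ 29 ∷ 61 ∷ [])
  ∷ (2 ∷ 3 ∷ 35 ∷ 39 ∷ 55 ∷ [])
  ∷ (4 ∷ 6 ∷ 14 ∷ 15 ∷ 47 ∷ [])
  ∷ (8 ∷ 9 ∷ 25 ∷ 57 ∷ 59 ∷ [])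
  ∷ (32 ∷ 40 ∷ 44 ∷ 60 ∷ 62 ∷ [])
  ∷ (33 ∷ 41 ∷ 43 ∷ [])
  ∷ (10 ∷ 11 ∷ 27 ∷ [])
  ∷ (36 ∷ 37 ∷ 45 ∷ [])
  ∷ (18 ∷ 19 ∷ 51 ∷ [])
  ∷ (17 ∷ 21 ∷ 53 ∷ [])
  ∷ (12 ∷ 28 ∷ 30 ∷ [])
  ∷ (24 ∷ 56 ∷ 58 ∷ [])
  ∷ (34 ∷ 42 ∷ 46 ∷ [])
  ∷ (48 ∷ 50 ∷ 54 ∷ [])
  ∷ (7 ∷ []) ∷ (26 ∷ []) ∷ (38 ∷ []) ∷ (49 ∷ []) ∷ (52 ∷ [])
  ∷ [] )

open import Data.List.Membership.DecPropositional (_≟_ {6}) using (_∈?_)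
open import Data.List.Membership.DecPropositional (×-≡-dec (_≟_ {6}) (_≟_ {6})) using () renaming (_∈?_ to _∈ᴱ?_)
open import Data.List.Relation.Unary.Unique.DecPropositional (_≟_ {6}) using (unique?)

symmetricChain : ∀ k {c : List (Vertex 6)} →
                 {True (k + k ≤? 6 ×-dec length c ≟ℕ suc (6 ∸ (k + k)) ×-dec weightsFrom? k c ×-dec linked? adjacent? c)} →
                 SymmetricChain 6 c
symmetricChain k {_} {p} = k , toWitness p

D₆-symmetricChains : All (SymmetricChain 6) D₆
D₆-symmetricChains =
    symmetricChain 0
  ∷ symmetricChain 1 ∷ symmetricChain 1 ∷ symmetricChain 1 ∷ symmetricChain 1 ∷ symmetricChain 1
  ∷ symmetricChain 2 ∷ symmetricChain 2 ∷ symmetricChain 2 ∷ symmetricChain 2 ∷ symmetricChain 2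
  ∷ symmetricChain 2 ∷ symmetricChain 2 ∷ symmetricChain 2 ∷ symmetricChain 2
  ∷ symmetricChain 3 ∷ symmetricChain 3 ∷ symmetricChain 3 ∷ symmetricChain 3 ∷ symmetricChain 3
  ∷ []

D₆-isSCD : SCD 6 D₆
D₆-isSCD = D₆-symmetricChains , from-yes (unique? (concat D₆)) , λ v → All.lookup covered (∈-bitstrings v)
  where covered = from-yes (All.all? (_∈? concat D₆) (bitstrings 6))

shielded : ∀ {x y} a b →
  {True ((a , y) ∈ᴱ? chainEdges D₆ ×-dec (y , b) ∈ᴱ? chainEdges D₆ ×-dec ¬? (a ≟ b) ×-dec ¬? (x ≟ a) ×-dec ¬? (x ≟ b))} →
  Shielded D₆ x y
shielded a b {p} = a , b , toWitness p

neighbourOf111000-shielded : ∀ i → Shielded D₆ (vertex 7) (flip i (vertex 7))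
neighbourOf111000-shielded zero                                = shielded (vertex 4)  (vertex 14)
neighbourOf111000-shielded (suc zero)                          = shielded (vertex 1)  (vertex 13)
neighbourOf111000-shielded (suc (suc zero))                    = shielded (vertex 2)  (vertex 35)
neighbourOf111000-shielded (suc (suc (suc zero)))              = shielded (vertex 14) (vertex 47)
neighbourOf111000-shielded (suc (suc (suc (suc zero))))        = shielded (vertex 22) (vertex 31)
neighbourOf111000-shielded (suc (suc (suc (suc (suc zero))))) = shielded (vertex 35) (vertex 55)

D₆-¬extendsToHamiltonCycle : ¬ ExtendsToHamiltonCycle 6 D₆
D₆-¬extendsToHamiltonCycle (c , hamiltonian@(unique , _) , contains)
  with y , adjacent , edge ← hamiltonCycle-adjacentNeighbour hamiltonian (vertex 7)
  with i , refl ← adjacent⇒flip {x = vertex 7} {y} adjacent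
  = Shielded⇒¬CycleEdge unique contains (neighbourOf111000-shielded i) (CycleEdge-sym {c = c} edge)

mainTheorem1 : ∃[ D ] (SCD 6 D × ¬ ExtendsToHamiltonCycle 6 D)
mainTheorem1 = D₆ , D₆-isSCD , D₆-¬extendsToHamiltonCycle
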